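{- Let $q$ be a prime number and let $\omega_q$ be the generalized Thue-Morse word over $\Sigma_q=\{0,\dots,q-1\}$. For every positive integer $m$, \[ I_{\omega_q}(m)\le \bigl(2\lceil \log_q m\rceil+q\bigr)(q-1)\,m . \]
   Context: $\omega_q=w_0w_1w_2\cdots$ with $w_i=s_q(i)$, the sum modulo $q$ of the base-$q$ digits of $i$. A finite word $u$ is an arithmetic factor of $\omega_q$ with difference $d\ge1$ if $u=w_cw_{c+d}\cdots w_{c+(|u|-1)d}$ for some $c\ge 0$. For an arithmetic factor $u$, its arithmetic index $i_{\omega_q}(u)$ is the length of the base-$q$ representation of the least $d\ge1$ such that $u$ is an arithmetic factor of $\omega_q$ with difference $d$. $I_{\omega_q}(m)$ is the maximum of $i_{\omega_q}(u)$ over all arithmetic factors $u$ of $\omega_q$ of length $m$. -}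

module Defs where

open import Data.Nat using (ℕ; zero; suc; _+_; _*_; _^_; _≤_; _<_; _≤ᵇ_; _<ᵇ_)
open import Data.Nat.DivMod using (_/_; _%_)
open import Data.Bool using (Bool; true; false; if_then_else_)
open import Data.Fin using (Fin; toℕ)
open import Data.Vec using (Vec; lookup)
open import Data.Product using (∃)
open import Relation.Binary.PropositionalEquality using (_≡_)
open import Relation.Nullary using (¬_)

-- Sum of base-q digits of i, computed with fuel (fuel = i suffices when q ≥ 2).
digitSumAux : ℕ → ℕ → ℕ → ℕ
digitSumAux zero          fuel       i = 0
digitSumAux (suc zero)    fuel       i = 0
digitSumAux (suc (suc k)) zero       i = 0
digitSumAux (suc (suc k)) (suc fuel) zero = 0
digitSumAux (suc (suc k)) (suc fuel) (suc i) =
  (suc i % suc (suc k)) + digitSumAux (suc (suc k)) fuel (suc i / suc (suc k))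

digitSum : ℕ → ℕ → ℕ
digitSum q i = digitSumAux q i i

ω : ℕ → ℕ → ℕ
ω zero    i = 0
ω (suc k) i = digitSum (suc k) i % suc k

IsArithFactorDiff : (q : ℕ) {m : ℕ} → Vec ℕ m → ℕ → Set
IsArithFactorDiff q {m} u d =
  1 ≤ d × ∃ λ c → (j : Fin m) → lookup u j ≡ ω q (c + toℕ j * d)
  where open import Data.Product using (_×_)

IsArithFactor : (q : ℕ) {m : ℕ} → Vec ℕ m → Set
IsArithFactor q u = ∃ λ d → IsArithFactorDiff q u d

IsLeastDiff : (q : ℕ) {m : ℕ} → Vec ℕ m → ℕ → Set
IsLeastDiff q u d =
  IsArithFactorDiff q u d × ((d' : ℕ) → d' < d → ¬ IsArithFactorDiff q u d')
  where open import Data.Product using (_×_)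

searchFrom : (ℕ → Bool) → ℕ → ℕ → ℕ
searchFrom p start zero       = start
searchFrom p start (suc fuel) = if p start then start else searchFrom p (suc start) fuel

-- length of the base-q representation of n (n ≥ 1, q ≥ 2):
-- the least k with n < q^k  (k ≤ n always suffices)
digitLength : ℕ → ℕ → ℕ
digitLength q n = searchFrom (λ k → n <ᵇ q ^ k) 0 n

-- ⌈log_q m⌉ (m ≥ 1, q ≥ 2): the least k with m ≤ q^k  (k ≤ m always suffices)
ceilLog : ℕ → ℕ → ℕ
ceilLog q m = searchFrom (λ k → m ≤ᵇ q ^ k) 0 m

module Submission where

-- We show that EVERY word U of length m over {0,…,q-1} is an
-- arithmetic factor of ω_q with the difference D = 1 + Q + … + Q^(m-1), the base-Q
-- repunit, where Q = q^(q+M).  The start c has base-Q digits (blocks)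
-- b_t = R(e_t)·P + (P - m + t) for t < m, where R(e) = (q-1)(1 + q + … + q^(e-1)) is
-- the repdigit of e digits q-1, of digit sum e(q-1).  Adding i·D adds i to every
-- block without overflow, so s_q(c + i·D) is the sum of the s_q(R(e_t)·P + z) with
-- z = P - m + i + t.  When z < P this is s_q(z) + e_t(q-1); when P ≤ z < 2P the carry
-- turns R(e_t) into a power of q and it is just s_q(z).  Hence letter i depends on
-- e_t only for t < m - i: a triangular system, solvable one e_t < q at a time since
-- q - 1 is invertible mod q.  So the least difference is ≤ D < Q^m, it has at most
-- (q+M)·m base-q digits, and (q+M)·m ≤ (2M+q)(q-1)·m.

open import Defs
open import Data.Nat using (ℕ; zero; suc; _+_; _*_; _∸_; _^_; _≤_; _<_; z≤n; s≤s; _<ᵇ_; _≤ᵇ_)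
open import Data.Nat.Properties
open import Data.Nat.DivMod
open import Data.Nat.Divisibility using (divides-refl)
open import Data.Nat.Tactic.RingSolver using (solve-∀)
open import Data.Nat.Primality using (Prime; prime⇒nonTrivial)
open import Data.Nat.Base using (nonTrivial⇒n>1)
open import Data.Bool using (Bool; true; false; T)
open import Data.Unit using (tt)
open import Data.Product using (Σ-syntax; ∃-syntax; _×_; _,_; proj₁; proj₂)
open import Data.Sum using (inj₁; inj₂)
open import Data.Vec using (Vec; []; _∷_; replicate; map; sum)
open import Data.Vec.Relation.Unary.All using (All; []; _∷_)
open import Data.Fin using (toℕ)
open import Data.Fin.Properties using (toℕ<n)
open import Function using (_∘_)
open import Relation.Binary.PropositionalEquality
open import Relation.Nullary using (contradiction)

searchFrom-≤ : ∀ (p : ℕ → Bool) start fuel k → start ≤ k → T (p k) → searchFrom p start fuel ≤ k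
searchFrom-≤ p s zero    k s≤k pk = s≤k
searchFrom-≤ p s (suc f) k s≤k pk with p s in ps
... | true  = s≤k
... | false = searchFrom-≤ p (suc s) f k (≤∧≢⇒< s≤k s≢k) pk
  where
  s≢k : s ≢ k
  s≢k refl = subst T ps pk

searchFrom-sound : ∀ (p : ℕ → Bool) start fuel → T (p (start + fuel)) → T (p (searchFrom p start fuel))
searchFrom-sound p s zero    h = subst (T ∘ p) (+-identityʳ s) h
searchFrom-sound p s (suc f) h with p s in ps
... | true  = subst T (sym ps) tt
... | false = searchFrom-sound p (suc s) f (subst (T ∘ p) (+-suc s f) h)

digitLength-≤ : ∀ q d n → d < q ^ n → digitLength q d ≤ n
digitLength-≤ q d n d<qⁿ = searchFrom-≤ (λ j → d <ᵇ q ^ j) 0 d n z≤n (<⇒<ᵇ d<qⁿ)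

-- For every base q = k + 2, n < q^n; this makes the search in ceilLog succeed.
n<[2+k]^n : ∀ k n → n < suc (suc k) ^ n
n<[2+k]^n k zero    = s≤s z≤n
n<[2+k]^n k (suc n) = begin-strict
    suc n                                       ≡⟨ +-comm 1 n ⟩
    n + 1                                       <⟨ +-mono-<-≤ (n<[2+k]^n k n) 1≤ ⟩
    q ^ n + (q ^ n + k * q ^ n)                 ≡⟨⟩
    q ^ suc n                                   ∎
  where
  open ≤-Reasoning
  q = suc (suc k)
  1≤ : 1 ≤ q ^ n + k * q ^ n
  1≤ = ≤-trans (m^n>0 q n) (m≤m+n _ _)

≤-pow-ceilLog : ∀ k m → m ≤ suc (suc k) ^ ceilLog (suc (suc k)) m
≤-pow-ceilLog k m =
  ≤ᵇ⇒≤ m _ (searchFrom-sound (λ j → m ≤ᵇ suc (suc k) ^ j) 0 m (≤⇒≤ᵇ (<⇒≤ (n<[2+k]^n k m))))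

window-head : ∀ {x n b} → x + suc n ≤ b → x < b
window-head {x} {n} {b} h = ≤-trans (s≤s (m≤m+n x n)) (subst (_≤ b) (+-suc x n) h)

window-tail : ∀ {x n b} → x + suc n ≤ b → suc x + n ≤ b
window-tail {x} {n} {b} h = subst (_≤ b) (+-suc x n) h

-- Since q - 1 ≡ -1 (mod q), adding e·(q-1) for a suitable e < q moves any residue
-- r < q to any prescribed residue v < q  (here q = k + 2).
residue-shift : ∀ k r v → r < suc (suc k) → v < suc (suc k) →
  ∃[ e ] e < suc (suc k) × ∃[ o ] r + e * suc k ≡ v + o * suc (suc k)
residue-shift k r v r<q v<q with ≤-<-connex v r
... | inj₁ v≤r with m≤n⇒∃[o]m+o≡n v≤r
...   | δ , refl = δ , ≤-<-trans (m≤n+m δ v) r<q , δ , lower v δ k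
  where
  lower : ∀ v δ k → v + δ + δ * suc k ≡ v + δ * suc (suc k)
  lower = solve-∀
residue-shift k r v r<q v<q | inj₂ r<v with m≤n⇒∃[o]m+o≡n r<v
... | g , refl with m≤n⇒∃[o]m+o≡n v<q
...   | w , refl = suc w + r , s≤s (s≤s w+r≤k) , w + r , upper r g w
  where
  w+r≤k : w + r ≤ r + g + w
  w+r≤k = ≤-trans (≤-reflexive (+-comm w r)) (+-monoˡ-≤ w (m≤m+n r g))
  upper : ∀ r g w →
    r + (suc w + r) * suc (r + g + w) ≡ suc r + g + (w + r) * suc (suc (r + g + w))
  upper = solve-∀

module Numerals (Q : ℕ) where

  fromDigits : ∀ {n} → Vec ℕ n → ℕ
  fromDigits []       = 0
  fromDigits (a ∷ as) = a + Q * fromDigits as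

  repunit : ℕ → ℕ
  repunit n = fromDigits (replicate n 1)

  repunit-pos : ∀ n → 1 ≤ n → 1 ≤ repunit n
  repunit-pos (suc n) _ = s≤s z≤n

  fromDigits-shift : ∀ {n} (as : Vec ℕ n) j → fromDigits as + j * repunit n ≡ fromDigits (map (_+ j) as)
  fromDigits-shift []       j = *-zeroʳ j
  fromDigits-shift {suc n} (a ∷ as) j = begin
      a + Q * fromDigits as + j * (1 + Q * repunit n)  ≡⟨ regroup Q a (fromDigits as) j (repunit n) ⟩
      a + j + Q * (fromDigits as + j * repunit n)      ≡⟨ cong (λ t → a + j + Q * t) (fromDigits-shift as j) ⟩
      a + j + Q * fromDigits (map (_+ j) as)           ∎
    where
    open ≡-Reasoning
    regroup : ∀ Q a A j R → a + Q * A + j * (1 + Q * R) ≡ a + j + Q * (A + j * R)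
    regroup = solve-∀

  repunit< : 1 < Q → ∀ n → repunit n < Q ^ n
  repunit< 1<Q zero    = s≤s z≤n
  repunit< 1<Q (suc n) = begin-strict
      1 + Q * repunit n    <⟨ +-monoˡ-< _ 1<Q ⟩
      Q + Q * repunit n    ≡⟨ *-suc Q _ ⟨
      Q * suc (repunit n)  ≤⟨ *-monoʳ-≤ Q (repunit< 1<Q n) ⟩
      Q * Q ^ n            ∎
    where open ≤-Reasoning

open Numerals using (fromDigits; fromDigits-shift; repunit; repunit-pos; repunit<)

module Base (k : ℕ) where

  q : ℕ
  q = suc (suc k)

  ds : ℕ → ℕ
  ds = digitSum q

  /q< : ∀ i → suc i / q ≤ i
  /q< i = ≤-pred (m/n<m (suc i) q (s≤s (s≤s z≤n)))

  digitSumAux-fuel : ∀ f g n → n ≤ f → n ≤ g → digitSumAux q f n ≡ digitSumAux q g n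
  digitSumAux-fuel zero    zero    zero    _ _ = refl
  digitSumAux-fuel zero    (suc g) zero    _ _ = refl
  digitSumAux-fuel (suc f) zero    zero    _ _ = refl
  digitSumAux-fuel (suc f) (suc g) zero    _ _ = refl
  digitSumAux-fuel (suc f) (suc g) (suc i) (s≤s i≤f) (s≤s i≤g) =
    cong (suc i % q +_) (digitSumAux-fuel f g (suc i / q) (≤-trans (/q< i) i≤f) (≤-trans (/q< i) i≤g))

  digitSum-step : ∀ n → ds n ≡ n % q + ds (n / q)
  digitSum-step zero    = refl
  digitSum-step (suc i) = cong (suc i % q +_) (digitSumAux-fuel i (suc i / q) (suc i / q) (/q< i) ≤-refl)

  digitSum-digit : ∀ x → x < q → ds x ≡ x
  digitSum-digit x x<q = begin
      ds x                ≡⟨ digitSum-step x ⟩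
      x % q + ds (x / q)  ≡⟨ cong₂ _+_ (m<n⇒m%n≡m x<q) (cong ds (m<n⇒m/n≡0 x<q)) ⟩
      x + 0               ≡⟨ +-identityʳ x ⟩
      x                   ∎
    where open ≡-Reasoning

  digitSum-concat : ∀ W x y → x < q ^ W → ds (x + q ^ W * y) ≡ ds x + ds y
  digitSum-concat zero    zero    y _ = cong ds (+-identityʳ y)
  digitSum-concat zero    (suc x) y (s≤s ())
  digitSum-concat (suc W) x y x<q^W+1 = begin
      ds (x + q ^ suc W * y)                       ≡⟨ cong (λ t → ds (x + t)) (trans (*-assoc q (q ^ W) y) (*-comm q (q ^ W * y))) ⟩
      ds (x + q ^ W * y * q)                       ≡⟨ digitSum-step (x + q ^ W * y * q) ⟩
      (x + q ^ W * y * q) % q + ds ((x + q ^ W * y * q) / q)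
                                                   ≡⟨ cong₂ _+_ ([m+kn]%n≡m%n x (q ^ W * y) q) (cong ds quotient) ⟩
      x % q + ds (x / q + q ^ W * y)               ≡⟨ cong (x % q +_) (digitSum-concat W (x / q) y x/q<q^W) ⟩
      x % q + (ds (x / q) + ds y)                  ≡⟨ +-assoc (x % q) _ _ ⟨
      x % q + ds (x / q) + ds y                    ≡⟨ cong (_+ ds y) (digitSum-step x) ⟨
      ds x + ds y                                  ∎
    where
    open ≡-Reasoning
    quotient : (x + q ^ W * y * q) / q ≡ x / q + q ^ W * y
    quotient = trans (+-distrib-/-∣ʳ x (divides-refl (q ^ W * y))) (cong (x / q +_) (m*n/n≡m (q ^ W * y) q))
    x/q<q^W : x / q < q ^ W
    x/q<q^W = m<n*o⇒m/o<n (subst (x <_) (*-comm q (q ^ W)) x<q^W+1)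

  digitSum-pow : ∀ e → ds (q ^ e) ≡ 1
  digitSum-pow e = trans (cong ds (sym (*-identityʳ (q ^ e)))) (digitSum-concat e 0 1 (m^n>0 q e))

  digitSum-fromDigits : ∀ W {n} (as : Vec ℕ n) → All (_< q ^ W) as → ds (fromDigits (q ^ W) as) ≡ sum (map ds as)
  digitSum-fromDigits W []       []          = refl
  digitSum-fromDigits W (a ∷ as) (a< ∷ as<) =
    trans (digitSum-concat W a _ a<) (cong (ds a +_) (digitSum-fromDigits W as as<))

  repdigit : ℕ → ℕ
  repdigit zero    = 0
  repdigit (suc e) = suc k + q * repdigit e

  digitSum-repdigit : ∀ e → ds (repdigit e) ≡ e * suc k
  digitSum-repdigit zero    = refl
  digitSum-repdigit (suc e) = begin
      ds (suc k + q * repdigit e)      ≡⟨ cong (λ t → ds (suc k + t * repdigit e)) (sym (*-identityʳ q)) ⟩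
      ds (suc k + q ^ 1 * repdigit e)  ≡⟨ digitSum-concat 1 (suc k) (repdigit e) top<q ⟩
      ds (suc k) + ds (repdigit e)     ≡⟨ cong₂ _+_ (digitSum-digit (suc k) ≤-refl) (digitSum-repdigit e) ⟩
      suc k + e * suc k                ∎
    where
    open ≡-Reasoning
    top<q : suc k < q ^ 1
    top<q = subst (suc k <_) (sym (*-identityʳ q)) (n<1+n (suc k))

  repdigit+1 : ∀ e → repdigit e + 1 ≡ q ^ e
  repdigit+1 zero    = refl
  repdigit+1 (suc e) = trans (carry k (repdigit e)) (cong (q *_) (repdigit+1 e))
    where
    carry : ∀ k r → suc k + suc (suc k) * r + 1 ≡ suc (suc k) * (r + 1)
    carry = solve-∀

  residue-choice : ∀ X v → v < q → ∃[ e ] e < q × (X + e * suc k) % q ≡ v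
  residue-choice X v v<q with residue-shift k (X % q) v (m%n<n X q) v<q
  ... | e , e<q , o , shifted = e , e<q , (begin
      (X + e * suc k) % q                  ≡⟨ cong (λ t → (t + e * suc k) % q) (m≡m%n+[m/n]*n X q) ⟩
      (X % q + X / q * q + e * suc k) % q  ≡⟨ cong (_% q) (swap (X % q) (X / q * q) (e * suc k)) ⟩
      (X % q + e * suc k + X / q * q) % q  ≡⟨ cong (λ t → (t + X / q * q) % q) shifted ⟩
      (v + o * q + X / q * q) % q          ≡⟨ [m+kn]%n≡m%n (v + o * q) (X / q) q ⟩
      (v + o * q) % q                      ≡⟨ [m+kn]%n≡m%n v o q ⟩
      v % q                                ≡⟨ m<n⇒m%n≡m v<q ⟩
      v                                    ∎)
    where
    open ≡-Reasoning
    swap : ∀ a b c → a + b + c ≡ a + c + b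
    swap = solve-∀

  module Carry (M : ℕ) where

    P : ℕ
    P = q ^ M

    digitSum-noCarry : ∀ e z → z < P → ds (repdigit e * P + z) ≡ ds z + e * suc k
    digitSum-noCarry e z z<P = begin
        ds (repdigit e * P + z)  ≡⟨ cong ds (trans (+-comm _ z) (cong (z +_) (*-comm (repdigit e) P))) ⟩
        ds (z + P * repdigit e)  ≡⟨ digitSum-concat M z (repdigit e) z<P ⟩
        ds z + ds (repdigit e)   ≡⟨ cong (ds z +_) (digitSum-repdigit e) ⟩
        ds z + e * suc k         ∎
      where open ≡-Reasoning

    -- ... while for P ≤ z < 2P the carry turns R(e) + 1 into q^e, of digit sum 1.
    digitSum-carry : ∀ e z → P ≤ z → z < P + P → ds (repdigit e * P + z) ≡ ds z
    digitSum-carry e z P≤z z<2P with m≤n⇒∃[o]m+o≡n P≤z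
    ... | w , refl = begin
        ds (repdigit e * P + (P + w))  ≡⟨ cong ds (regroup (repdigit e) P w) ⟩
        ds (w + P * (repdigit e + 1))  ≡⟨ digitSum-concat M w (repdigit e + 1) w<P ⟩
        ds w + ds (repdigit e + 1)     ≡⟨ cong (λ t → ds w + ds t) (repdigit+1 e) ⟩
        ds w + ds (q ^ e)              ≡⟨ cong (ds w +_) (digitSum-pow e) ⟩
        ds w + ds 1                    ≡⟨ digitSum-concat M w 1 w<P ⟨
        ds (w + P * 1)                 ≡⟨ cong ds (trans (cong (w +_) (*-identityʳ P)) (+-comm w P)) ⟩
        ds (P + w)                     ∎
      where
      open ≡-Reasoning
      w<P : w < P
      w<P = +-cancelˡ-< P w P z<2P
      regroup : ∀ r P w → r * P + (P + w) ≡ w + P * (r + 1)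
      regroup = solve-∀

    blocks : ∀ {n} → ℕ → Vec ℕ n → Vec ℕ n
    blocks x []       = []
    blocks x (e ∷ es) = (repdigit e * P + x) ∷ blocks (suc x) es

    blocks-shift : ∀ {n} x (es : Vec ℕ n) j → map (_+ j) (blocks x es) ≡ blocks (x + j) es
    blocks-shift x []       j = refl
    blocks-shift x (e ∷ es) j = cong₂ _∷_ (+-assoc (repdigit e * P) x j) (blocks-shift (suc x) es j)

    windowSum : ∀ {n} → ℕ → Vec ℕ n → ℕ
    windowSum x es = sum (map ds (blocks x es))

    plainSum : ℕ → ℕ → ℕ
    plainSum x zero    = 0
    plainSum x (suc n) = ds x + plainSum (suc x) n

    windowSum-carried : ∀ {n} x (es : Vec ℕ n) → P ≤ x → x + n ≤ P + P → windowSum x es ≡ plainSum x n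
    windowSum-carried x []       _   _   = refl
    windowSum-carried x (e ∷ es) P≤x fit =
      cong₂ _+_ (digitSum-carry e x P≤x (window-head fit))
                (windowSum-carried (suc x) es (≤-trans P≤x (n≤1+n x)) (window-tail fit))

    -- The first block is
    -- uncarried only at j = n - 1, which fixes e_0; the other blocks are solved
    -- recursively with the contribution of the first block absorbed into h.
    solve-triangular : ∀ n B → B + n ≡ P → (h u : ℕ → ℕ) → (∀ j → j < n → u j < q) →
      Σ[ es ∈ Vec ℕ n ] All (_< q) es × (∀ j → j < n → (h j + windowSum (B + j) es) % q ≡ u j)
    solve-triangular zero    B _   h u _   = [] , [] , λ _ ()
    solve-triangular (suc n) B fit h u u<q = e₀ ∷ es , e₀<q ∷ es<q , solved
      where
      last+1≡P : suc (B + n) ≡ P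
      last+1≡P = trans (sym (+-suc B n)) fit
      later : ∀ (es : Vec ℕ n) → windowSum (suc (B + n)) es ≡ plainSum (suc (B + n)) n
      later es = windowSum-carried (suc (B + n)) es (≤-reflexive (sym last+1≡P))
        (subst (λ p → p + n ≤ P + P) (sym last+1≡P) (+-monoʳ-≤ P (≤-trans (m≤n+m n (suc B)) (≤-reflexive last+1≡P))))
      X : ℕ
      X = h n + ds (B + n) + plainSum (suc (B + n)) n
      choice = residue-choice X (u n) (u<q n ≤-refl)
      e₀ = proj₁ choice
      e₀<q = proj₁ (proj₂ choice)
      rest = solve-triangular n (suc B) last+1≡P (λ j → h j + ds (repdigit e₀ * P + (B + j))) u
               (λ j j<n → u<q j (m<n⇒m<1+n j<n))
      es = proj₁ rest
      es<q = proj₁ (proj₂ rest)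
      regroup : ∀ a b c d → a + ((b + c) + d) ≡ a + b + d + c
      regroup = solve-∀
      solved : ∀ j → j < suc n → (h j + windowSum (B + j) (e₀ ∷ es)) % q ≡ u j
      solved j j<1+n with m<1+n⇒m<n∨m≡n j<1+n
      ... | inj₁ j<n  = trans (cong (_% q) (sym (+-assoc (h j) _ _))) (proj₂ (proj₂ rest) j j<n)
      ... | inj₂ refl = begin
          (h n + (ds (repdigit e₀ * P + (B + n)) + windowSum (suc (B + n)) es)) % q
            ≡⟨ cong₂ (λ a b → (h n + (a + b)) % q) (digitSum-noCarry e₀ (B + n) (≤-reflexive last+1≡P)) (later es) ⟩
          (h n + ((ds (B + n) + e₀ * suc k) + plainSum (suc (B + n)) n)) % q
            ≡⟨ cong (_% q) (regroup (h n) (ds (B + n)) (e₀ * suc k) (plainSum (suc (B + n)) n)) ⟩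
          (X + e₀ * suc k) % q
            ≡⟨ proj₂ (proj₂ choice) ⟩
          u n ∎
        where open ≡-Reasoning

    -- Blocks have at most W = q + M digits, so they do not interact in base Q = q^W.
    W : ℕ
    W = q + M

    Q : ℕ
    Q = q ^ W

    block<Q : ∀ e z → e < q → z < P + P → repdigit e * P + z < Q
    block<Q e z e<q z<2P = begin-strict
        repdigit e * P + z          <⟨ +-monoʳ-< (repdigit e * P) z<2P ⟩
        repdigit e * P + (P + P)    ≡⟨ regroup (repdigit e) P ⟩
        (repdigit e + 1 + 1) * P    ≡⟨ cong (λ t → (t + 1) * P) (repdigit+1 e) ⟩
        (q ^ e + 1) * P             ≤⟨ *-monoˡ-≤ P (+-monoʳ-≤ (q ^ e) (≤-trans (m^n>0 q e) (m≤m+n _ _))) ⟩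
        q ^ suc e * P               ≤⟨ *-monoˡ-≤ P (^-monoʳ-≤ q e<q) ⟩
        q ^ q * P                   ≡⟨ ^-distribˡ-+-* q q M ⟨
        Q                           ∎
      where
      open ≤-Reasoning
      regroup : ∀ r P → r * P + (P + P) ≡ (r + 1 + 1) * P
      regroup = solve-∀

    blocks<Q : ∀ {n} x (es : Vec ℕ n) → All (_< q) es → x + n ≤ P + P → All (_< Q) (blocks x es)
    blocks<Q x []       []          _   = []
    blocks<Q x (e ∷ es) (e< ∷ es<) fit =
      block<Q e x e< (window-head fit) ∷ blocks<Q (suc x) es es< (window-tail fit)

    realize : ∀ m → m ≤ P → (U : ℕ → ℕ) → (∀ j → j < m → U j < q) →
      ∃[ c ] ∀ j → j < m → ω q (c + j * repunit Q m) ≡ U j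
    realize m m≤P U U<q = c , letter
      where
      B : ℕ
      B = P ∸ m
      fit : B + m ≡ P
      fit = m∸n+n≡m m≤P
      solution = solve-triangular m B fit (λ _ → 0) U U<q
      es = proj₁ solution
      c : ℕ
      c = fromDigits Q (blocks B es)
      window-fits : ∀ j → j < m → B + j + m ≤ P + P
      window-fits j j<m = begin
        B + j + m    ≡⟨ +-assoc B j m ⟩
        B + (j + m)  ≡⟨ cong (B +_) (+-comm j m) ⟩
        B + (m + j)  ≡⟨ +-assoc B m j ⟨
        B + m + j    ≡⟨ cong (_+ j) fit ⟩
        P + j        ≤⟨ +-monoʳ-≤ P (≤-trans (<⇒≤ j<m) m≤P) ⟩
        P + P        ∎
        where open ≤-Reasoning
      letter : ∀ j → j < m → ω q (c + j * repunit Q m) ≡ U j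
      letter j j<m = begin
          ds (c + j * repunit Q m) % q             ≡⟨ cong (λ t → ds t % q) (fromDigits-shift Q (blocks B es) j) ⟩
          ds (fromDigits Q (map (_+ j) (blocks B es))) % q
                                                   ≡⟨ cong (λ bs → ds (fromDigits Q bs) % q) (blocks-shift B es j) ⟩
          ds (fromDigits Q (blocks (B + j) es)) % q
                                                   ≡⟨ cong (_% q) (digitSum-fromDigits W (blocks (B + j) es)
                                                        (blocks<Q (B + j) es (proj₁ (proj₂ solution)) (window-fits j j<m))) ⟩
          windowSum (B + j) es % q                 ≡⟨ proj₂ (proj₂ solution) j j<m ⟩
          U j                                      ∎
        where open ≡-Reasoning

    leastDiff-digitLength : ∀ m → 1 ≤ m → m ≤ P → (u : Vec ℕ m) → IsArithFactor q u →
      ∀ d → IsLeastDiff q u d → digitLength q d ≤ W * m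
    leastDiff-digitLength m 1≤m m≤P u (d₀ , _ , c₀ , u≡ω) d (_ , least) =
      digitLength-≤ q d (W * m) (≤-<-trans d≤D D<q^[Wm])
      where
      U : ℕ → ℕ
      U j = ω q (c₀ + j * d₀)
      realized = realize m m≤P U (λ j _ → m%n<n (ds (c₀ + j * d₀)) q)
      D-factor : IsArithFactorDiff q u (repunit Q m)
      D-factor = repunit-pos Q m 1≤m , proj₁ realized ,
                 λ j → trans (u≡ω j) (sym (proj₂ realized (toℕ j) (toℕ<n j)))
      d≤D : d ≤ repunit Q m
      d≤D = ≮⇒≥ (λ D<d → least (repunit Q m) D<d D-factor)
      1<Q : 1 < Q
      1<Q = ≤-trans (s≤s (s≤s z≤n)) (≤-trans (≤-reflexive (sym (*-identityʳ q))) (*-monoʳ-≤ q (m^n>0 q (suc (k + M)))))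
      D<q^[Wm] : repunit Q m < q ^ (W * m)
      D<q^[Wm] = subst (repunit Q m <_) (^-*-assoc q W m) (repunit< Q 1<Q m)

mainTheorem5 : (q : ℕ) → Prime q → (m : ℕ) → 1 ≤ m →
    (u : Vec ℕ m) → IsArithFactor q u → (d : ℕ) → IsLeastDiff q u d →
    digitLength q d ≤ (2 * ceilLog q m + q) * (q ∸ 1) * m
mainTheorem5 (suc (suc k)) _ m 1≤m u factor d least = begin
    digitLength q d            ≤⟨ leastDiff-digitLength m 1≤m (≤-pow-ceilLog k m) u factor d least ⟩
    (q + M) * m                ≤⟨ *-monoˡ-≤ m (≤-trans q+M≤2M+q (m≤m*n (2 * M + q) (suc k))) ⟩
    (2 * M + q) * suc k * m    ∎
  where
  open ≤-Reasoning
  open Base k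
  M = ceilLog q m
  open Carry M
  q+M≤2M+q : q + M ≤ 2 * M + q
  q+M≤2M+q = ≤-trans (≤-reflexive (+-comm q M)) (+-monoˡ-≤ q (m≤m+n M (M + 0)))
mainTheorem5 zero       p = contradiction (nonTrivial⇒n>1 0 {{prime⇒nonTrivial p}}) λ ()
mainTheorem5 (suc zero) p = contradiction (nonTrivial⇒n>1 1 {{prime⇒nonTrivial p}}) (<-irrefl refl)
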